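{- Let $\mathcal N=(P,T,W^-,W^+,m_0)$ be a Petri net and let $\overline m_0$ be any initial marking of its reaction Petri net $\mathcal A$. The regulated Petri net $\mathcal A\odot\mathcal N$ is weakly reversible if and only if $\mathcal N$ is weakly reversible. Moreover, $\mathcal A\odot\mathcal N$ has deficiency $0$.
   Context: A Petri net is $(P,T,W^-,W^+,m_0)$ with finite disjoint $P,T$, $W^-,W^+\in\mathbb N^{P\times T}$, initial marking $m_0\in\mathbb N^P$; $W=W^+-W^-$. ${}^\bullet t$, $t^\bullet$ are the columns of $W^-$, $W^+$ at $t$. Complexes: $\mathcal C=\{{}^\bullet t: t\in T\}\cup\{t^\bullet: t\in T\}$; reaction graph: nodes $\mathcal C$, arcs $({}^\bullet t,t^\bullet)$. Weakly reversible: every connected component of the reaction graph is strongly connected. Deficiency: $|\mathcal C|-\ell-\mathrm{rank}(W)$, $\ell$ the number of connected components of the reaction graph. The reaction Petri net of $\mathcal N$ is $\mathcal A=(\mathcal C,T,\overline W^-,\overline W^+)$ with, for every $t$, $\overline W^-({}^\bullet t,t)=1$, $\overline W^-(u,t)=0$ for $u\neq{}^\bullet t$, $\overline W^+(t^\bullet,t)=1$, $\overline W^+(u,t)=0$ for $u\ne t^\bullet$. The regulated net is $\mathcal A\odot\mathcal N=(P\sqcup\mathcal C,T,\widetilde W^-,\widetilde W^+,(m_0,\overline m_0))$ where $\widetilde W^-$ is $W^-$ stacked above $\overline W^-$ and $\widetilde W^+$ is $W^+$ stacked above $\overline W^+$. -}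

module Defs where

open import Data.Nat using (ℕ; zero; suc; _+_)
open import Data.Integer as ℤ using (ℤ; +_)
open import Data.Fin using (Fin; zero; suc; splitAt; _≟_)
open import Data.Vec using (Vec; tabulate)
open import Data.Sum using (_⊎_; [_,_])
open import Data.Product using (Σ; Σ-syntax; ∃; ∃-syntax; _×_; _,_)
open import Function.Definitions using (Injective)
open import Relation.Nullary using (¬_; does)
open import Data.Bool using (if_then_else_)
open import Relation.Binary.PropositionalEquality using (_≡_)
open import Relation.Binary.Construct.Closure.ReflexiveTransitive using (Star)
open import Relation.Binary.Construct.Closure.Equivalence using (EqClosure)

-- Petri nets with transition set Fin t and place set Fin p
-- (pre = W⁻, post = W⁺, both P × T matrices; m0 initial marking)

record Net (t : ℕ) : Set where
  field
    p    : ℕ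
    pre  : Fin p → Fin t → ℕ
    post : Fin p → Fin t → ℕ
    m0   : Fin p → ℕ

open Net public

W : ∀ {t} (N : Net t) → Fin (p N) → Fin t → ℤ
W N i j = (+ post N i j) ℤ.- (+ pre N i j)

inC : ∀ {t} (N : Net t) → Fin t → Vec ℕ (p N)
inC N j = tabulate (λ i → pre N i j)

outC : ∀ {t} (N : Net t) → Fin t → Vec ℕ (p N)
outC N j = tabulate (λ i → post N i j)

Arc : ∀ {t} (N : Net t) → Vec ℕ (p N) → Vec ℕ (p N) → Set
Arc N u v = ∃[ j ] (inC N j ≡ u × outC N j ≡ v)

SameComponent : ∀ {t} (N : Net t) → Vec ℕ (p N) → Vec ℕ (p N) → Set
SameComponent N = EqClosure (Arc N)

Reach : ∀ {t} (N : Net t) → Vec ℕ (p N) → Vec ℕ (p N) → Set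
Reach N = Star (Arc N)

WeaklyReversible : ∀ {t} → Net t → Set
WeaklyReversible N = ∀ u v → SameComponent N u v → Reach N u v

-- An enumeration of the set of complexes C by Fin c (so |C| = c):
-- an injective naming Fin c → ℕ^P whose image is exactly C.

record Indexing {t} (N : Net t) (c : ℕ) : Set where
  field
    name     : Fin c → Vec ℕ (p N)
    name-inj : Injective _≡_ _≡_ name
    src      : Fin t → Fin c
    tgt      : Fin t → Fin c
    src-ok   : ∀ j → name (src j) ≡ inC N j
    tgt-ok   : ∀ j → name (tgt j) ≡ outC N j
    cover    : ∀ k → ∃[ j ] (src j ≡ k ⊎ tgt j ≡ k)

open Indexing public

NumComponents : ∀ {t} {N : Net t} {c} → Indexing N c → ℕ → Set
NumComponents {N = N} {c} I ℓ =
  Σ[ comp ∈ (Fin c → Fin ℓ) ]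
    ((∀ x → ∃[ k ] (comp k ≡ x)) ×
     (∀ k k′ → (comp k ≡ comp k′ → SameComponent N (name I k) (name I k′))
                × (SameComponent N (name I k) (name I k′) → comp k ≡ comp k′)))

-- Rank of an integer matrix: the maximal number of linearly
-- independent columns (over ℤ, equivalently over ℚ).

sumℤ : ∀ {n} → (Fin n → ℤ) → ℤ
sumℤ {zero}  f = + 0
sumℤ {suc n} f = f zero ℤ.+ sumℤ (λ k → f (suc k))

ColsIndependent : ∀ {p t r} → (Fin p → Fin t → ℤ) → (Fin r → Fin t) → Set
ColsIndependent M s =
  ∀ (a : _ → ℤ) → (∀ i → sumℤ (λ k → a k ℤ.* M i (s k)) ≡ + 0) → ∀ k → a k ≡ + 0

HasRank : ∀ {p t} → (Fin p → Fin t → ℤ) → ℕ → Set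
HasRank {t = t} M r =
  (Σ[ s ∈ (Fin r → Fin t) ] (Injective _≡_ _≡_ s × ColsIndependent M s)) ×
  (∀ (s : Fin (suc r) → Fin t) → Injective _≡_ _≡_ s → ¬ ColsIndependent M s)

HasDeficiency : ∀ {t} → Net t → ℤ → Set
HasDeficiency N d =
  Σ[ c ∈ ℕ ] Σ[ I ∈ Indexing N c ] Σ[ ℓ ∈ ℕ ] (NumComponents I ℓ ×
  Σ[ r ∈ ℕ ] (HasRank (W N) r × d ≡ (+ c) ℤ.- (+ ℓ) ℤ.- (+ r)))

δ : ∀ {c} → Fin c → Fin c → ℕ
δ k k′ = if does (k ≟ k′) then 1 else 0

reactionNet : ∀ {t} (N : Net t) {c} → Indexing N c → (Fin c → ℕ) → Net t
reactionNet N {c} I m̄0 = record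
  { p    = c
  ; pre  = λ k j → δ (src I j) k
  ; post = λ k j → δ (tgt I j) k
  ; m0   = m̄0
  }

-- regulated net A ⊙ N: places P ⊔ C (N's places first), matrices stacked
_⊙_ : ∀ {t} → Net t → Net t → Net t
A ⊙ N = record
  { p    = p N + p A
  ; pre  = λ i j → [ (λ a → pre N a j) , (λ b → pre A b j) ] (splitAt (p N) i)
  ; post = λ i j → [ (λ a → post N a j) , (λ b → post A b j) ] (splitAt (p N) i)
  ; m0   = λ i → [ m0 N , m0 A ] (splitAt (p N) i)
  }

-- The complexes of A ⊙ N are those of N with the unit vector of the corresponding
-- reaction place appended.  This is an injective relabelling of complexes that keeps
-- every arc, so both nets have the same reaction graph, which gives the equivalence of
-- weak reversibility.  The rows of W indexed by the reaction places form the incidence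
-- matrix of the reaction graph, and every row of W is a potential difference
-- y(t•) - y(•t), hence a combination of those rows.  So rank W is the rank of the
-- incidence matrix, i.e. |C| - ℓ: adding the arcs one at a time (Kruskal) yields a
-- spanning forest with |C| - ℓ independent arcs, and any |C| - ℓ + 1 arcs contain a
-- cycle, since otherwise they would split the complexes into fewer than ℓ classes.

module Submission where

open import Defs
open import Data.Nat as ℕ using (ℕ; zero; suc; pred; _<_)
import Data.Nat.Properties as ℕP
open import Data.Integer using (ℤ; +_; 0ℤ; -1ℤ; _+_; _*_; _-_; -_)
import Data.Integer.Properties as ℤP
open import Data.Integer.Tactic.RingSolver using (solve-∀)
open import Data.Fin using (Fin; zero; suc; _≟_; splitAt; _↑ʳ_; punchIn; punchOut; lift)
open import Data.Fin.Properties
  using (suc-injective; splitAt-↑ʳ; punchOut-cong; punchOut-injective; punchInᵢ≢i;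
         punchOut-punchIn; lift-injective; injective⇒≤; nonZeroIndex)
open import Data.Vec using (Vec; tabulate; lookup)
open import Data.Vec.Properties using (lookup∘tabulate; tabulate-cong)
open import Data.Vec.Functional using (_∷_)
open import Data.Product as Σ using (∃-syntax; _×_; _,_; proj₁; proj₂)
open import Data.Sum as ⊎ using (_⊎_; inj₁; inj₂; [_,_]; fromInj₁; fromInj₂)
open import Data.Sum.Properties using ([,]-cong)
open import Data.Empty using (⊥-elim)
open import Function using (_∘_; id)
open import Function.Bundles using (_⇔_; mk⇔)
open import Function.Construct.Symmetry using (⇔-sym)
open import Function.Construct.Composition using (_⇔-∘_)
open import Function.Definitions using (Injective)
open import Relation.Nullary using (¬_; yes; no)
open import Relation.Binary.PropositionalEquality hiding ([_])
open import Relation.Binary.Construct.Closure.ReflexiveTransitive as Star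
  using (Star; ε; _◅_; _◅◅_)
open import Relation.Binary.Construct.Closure.Symmetric using (SymClosure; fwd; bwd)
open import Relation.Binary.Construct.Closure.Equivalence as EqClosure using (EqClosure)
open import Algebra.Properties.Semiring.Sum ℤP.+-*-semiring
  using (sum; sum-cong-≗; sum-replicate-zero; ∑-distrib-+; ∑-comm; *-distribˡ-sum; *-distribʳ-sum)
open import Algebra.Properties.Ring ℤP.+-*-ring using ([y-z]x≈yx-zx)

open ≡-Reasoning

sumℤ≡sum : ∀ {n} (f : Fin n → ℤ) → sumℤ f ≡ sum f
sumℤ≡sum {zero}  f = refl
sumℤ≡sum {suc n} f = cong (_+_ (f zero)) (sumℤ≡sum (f ∘ suc))

sum-zero : ∀ {n} {f : Fin n → ℤ} → (∀ k → f k ≡ 0ℤ) → sum f ≡ 0ℤ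
sum-zero {n} f≗0 = trans (sum-cong-≗ f≗0) (sum-replicate-zero n)

sum-neg : ∀ {n} (f : Fin n → ℤ) → sum (λ k → - f k) ≡ - sum f
sum-neg f = begin
  sum (λ k → - f k)      ≡⟨ sum-cong-≗ (sym ∘ ℤP.-1*i≡-i ∘ f) ⟩
  sum (λ k → -1ℤ * f k)  ≡⟨ sym (*-distribˡ-sum -1ℤ f) ⟩
  -1ℤ * sum f            ≡⟨ ℤP.-1*i≡-i (sum f) ⟩
  - sum f                ∎

∑-distrib-- : ∀ {n} (f g : Fin n → ℤ) → sum (λ k → f k - g k) ≡ sum f - sum g
∑-distrib-- f g = trans (∑-distrib-+ f (λ k → - g k)) (cong (_+_ (sum f)) (sum-neg g))

δ-refl : ∀ {n} (k : Fin n) → δ k k ≡ 1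
δ-refl zero    = refl
δ-refl (suc k) = δ-refl k

δ-≢ : ∀ {n} {k k′ : Fin n} → k ≢ k′ → δ k k′ ≡ 0
δ-≢ {k = k} {k′} k≢k′ with k ≟ k′
... | yes k≡k′ = ⊥-elim (k≢k′ k≡k′)
... | no _     = refl

δ≡1⇒≡ : ∀ {n} {k k′ : Fin n} → δ k k′ ≡ 1 → k ≡ k′
δ≡1⇒≡ {k = k} {k′} δ≡1 with k ≟ k′ | δ≡1
... | yes k≡k′ | _ = k≡k′
... | no _     | ()

sum-δ : ∀ {n} (g : Fin n → ℤ) (x : Fin n) → sum (λ k → + δ x k * g k) ≡ g x
sum-δ g zero = begin
  + 1 * g zero + sum (λ k → 0ℤ * g (suc k))
    ≡⟨ cong₂ _+_ (ℤP.*-identityˡ (g zero)) (sum-zero (ℤP.*-zeroˡ ∘ g ∘ suc)) ⟩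
  g zero + 0ℤ
    ≡⟨ ℤP.+-identityʳ (g zero) ⟩
  g zero ∎
sum-δ g (suc x) = trans (ℤP.+-identityˡ _) (sum-δ (g ∘ suc) x)

m+n-m-n≡0 : ∀ m n → 0ℤ ≡ + (m ℕ.+ n) - + m - + n
m+n-m-n≡0 m n = trans (cancel (+ m) (+ n)) (cong (λ z → z - + m - + n) (sym (ℤP.pos-+ m n)))
  where
  cancel : ∀ a b → 0ℤ ≡ a + b - a - b
  cancel = solve-∀

lookup-tabulate : ∀ {n} {v : Vec ℕ n} {f : Fin n → ℕ} → v ≡ tabulate f → ∀ i → lookup v i ≡ f i
lookup-tabulate refl = lookup∘tabulate _

lift-Star : ∀ {A B : Set} {R : A → A → Set} {S : B → B → Set} (f : A → B) →
  (∀ {a y} → S (f a) y → ∃[ b ] (f b ≡ y × R a b)) →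
  ∀ {a y} → Star S (f a) y → ∃[ b ] (f b ≡ y × Star R a b)
lift-Star f lift-step ε = _ , refl , ε
lift-Star f lift-step (s ◅ ss) with lift-step s
... | b , refl , r = Σ.map₂ (Σ.map₂ (r ◅_)) (lift-Star f lift-step ss)

merge : ∀ {n} (x y : Fin n) → x ≢ y → Fin n → Fin (pred n)
merge {suc n} x y x≢y z with z ≟ y
... | yes _   = punchOut (x≢y ∘ sym)
... | no z≢y  = punchOut (z≢y ∘ sym)

merge-identifies : ∀ {n} (x y : Fin n) (x≢y : x ≢ y) → merge x y x≢y x ≡ merge x y x≢y y
merge-identifies {suc n} x y x≢y with x ≟ y | y ≟ y
... | yes x≡y | _       = ⊥-elim (x≢y x≡y)
... | no _    | no y≢y  = ⊥-elim (y≢y refl)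
... | no _    | yes _   = punchOut-cong y refl

merge-fibres : ∀ {n} (x y : Fin n) (x≢y : x ≢ y) z z′ → merge x y x≢y z ≡ merge x y x≢y z′ →
  z ≡ z′ ⊎ ((z ≡ x ⊎ z ≡ y) × (z′ ≡ x ⊎ z′ ≡ y))
merge-fibres {suc n} x y x≢y z z′ with z ≟ y | z′ ≟ y
... | yes z≡y | yes z′≡y = λ _ → inj₁ (trans z≡y (sym z′≡y))
... | yes z≡y | no _     = λ eq → inj₂ (inj₂ z≡y , inj₁ (sym (punchOut-injective {i = y} _ _ eq)))
... | no _    | yes z′≡y = λ eq → inj₂ (inj₁ (punchOut-injective {i = y} _ _ eq) , inj₂ z′≡y)
... | no _    | no _     = λ eq → inj₁ (punchOut-injective {i = y} _ _ eq)

merge-surjective : ∀ {n} (x y : Fin n) (x≢y : x ≢ y) w → ∃[ z ] merge x y x≢y z ≡ w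
merge-surjective {suc n} x y x≢y w = punchIn y w , merge-punchIn
  where
  merge-punchIn : merge x y x≢y (punchIn y w) ≡ w
  merge-punchIn with punchIn y w ≟ y
  ... | yes p≡y = ⊥-elim (punchInᵢ≢i y w p≡y)
  ... | no _    = trans (punchOut-cong y refl) (punchOut-punchIn y)

module Graph {c t : ℕ} (src tgt : Fin t → Fin c) where

  Edge : ∀ {m} → (Fin m → Fin t) → Fin c → Fin c → Set
  Edge e k k′ = ∃[ i ] (src (e i) ≡ k × tgt (e i) ≡ k′)

  Connected : ∀ {m} → (Fin m → Fin t) → Fin c → Fin c → Set
  Connected e = EqClosure (Edge e)

  WeaklyReversibleGraph : Set
  WeaklyReversibleGraph = ∀ {k k′} → Connected id k k′ → Star (Edge id) k k′

  ∂ : (Fin c → ℤ) → Fin t → ℤ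
  ∂ y j = y (tgt j) - y (src j)

  -- ∑ᵢ aᵢ (1_{tgt (e i)} - 1_{src (e i)}) = 0, tested against every potential y.
  IsCycle : ∀ {m} → (Fin m → Fin t) → (Fin m → ℤ) → Set
  IsCycle e a = ∀ y → sum (λ i → a i * ∂ y (e i)) ≡ 0ℤ

  Independent : ∀ {m} → (Fin m → Fin t) → Set
  Independent e = ∀ a → IsCycle e a → ∀ i → a i ≡ 0ℤ

  Dependent : ∀ {m} → (Fin m → Fin t) → Set
  Dependent e = ∃[ a ] (IsCycle e a × ∃[ i ] a i ≢ 0ℤ)

  ∂-vanishes : ∀ {n} (h : Fin n → ℤ) (φ : Fin c → Fin n) {j} →
    φ (src j) ≡ φ (tgt j) → ∂ (h ∘ φ) j ≡ 0ℤ
  ∂-vanishes h φ {j} eq =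
    trans (cong (λ z → h z - h (φ (src j))) (sym eq)) (ℤP.+-inverseʳ (h (φ (src j))))

  basis : Fin c → Fin c → ℤ
  basis b k = + δ k b

  ∂-expand : ∀ y j → ∂ y j ≡ sum (λ b → ∂ (basis b) j * y b)
  ∂-expand y j = sym (begin
    sum (λ b → (+ δ (tgt j) b - + δ (src j) b) * y b)
      ≡⟨ sum-cong-≗ (λ b → [y-z]x≈yx-zx (y b) (+ δ (tgt j) b) (+ δ (src j) b)) ⟩
    sum (λ b → + δ (tgt j) b * y b - + δ (src j) b * y b)
      ≡⟨ ∑-distrib-- (λ b → + δ (tgt j) b * y b) (λ b → + δ (src j) b * y b) ⟩
    sum (λ b → + δ (tgt j) b * y b) - sum (λ b → + δ (src j) b * y b)
      ≡⟨ cong₂ _-_ (sum-δ y (tgt j)) (sum-δ y (src j)) ⟩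
    ∂ y j ∎)

  isCycle-from-basis : ∀ {m} (e : Fin m → Fin t) (a : Fin m → ℤ) →
    (∀ b → sum (λ i → a i * ∂ (basis b) (e i)) ≡ 0ℤ) → IsCycle e a
  isCycle-from-basis e a basis-cycle y = begin
    sum (λ i → a i * ∂ y (e i))
      ≡⟨ sum-cong-≗ (λ i → cong (a i *_) (∂-expand y (e i))) ⟩
    sum (λ i → a i * sum (λ b → ∂ (basis b) (e i) * y b))
      ≡⟨ sum-cong-≗ (λ i → *-distribˡ-sum (a i) (λ b → ∂ (basis b) (e i) * y b)) ⟩
    sum (λ i → sum (λ b → a i * (∂ (basis b) (e i) * y b)))
      ≡⟨ ∑-comm (λ i b → a i * (∂ (basis b) (e i) * y b)) ⟩
    sum (λ b → sum (λ i → a i * (∂ (basis b) (e i) * y b)))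
      ≡⟨ sum-cong-≗ (λ b →
           trans (sum-cong-≗ (λ i → sym (ℤP.*-assoc (a i) (∂ (basis b) (e i)) (y b))))
                 (sym (*-distribʳ-sum (y b) (λ i → a i * ∂ (basis b) (e i))))) ⟩
    sum (λ b → sum (λ i → a i * ∂ (basis b) (e i)) * y b)
      ≡⟨ sum-zero (λ b → cong (_* y b) (basis-cycle b)) ⟩
    0ℤ ∎

  connected⇒boundary : ∀ {m} (e : Fin m → Fin t) {u v} → Connected e u v →
    ∃[ b ] ∀ y → sum (λ i → b i * ∂ y (e i)) ≡ y v - y u
  connected⇒boundary e {u} ε = (λ _ → 0ℤ) , λ y →
    trans (sum-zero (λ i → ℤP.*-zeroˡ (∂ y (e i)))) (sym (ℤP.+-inverseʳ (y u)))
  connected⇒boundary e {v = v} (fwd (i , refl , refl) ◅ rest) with connected⇒boundary e rest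
  ... | b , b-boundary = (λ i′ → b i′ + + δ i i′) , λ y → begin
    sum (λ i′ → (b i′ + + δ i i′) * ∂ y (e i′))
      ≡⟨ sum-cong-≗ (λ i′ → ℤP.*-distribʳ-+ (∂ y (e i′)) (b i′) _) ⟩
    sum (λ i′ → b i′ * ∂ y (e i′) + + δ i i′ * ∂ y (e i′))
      ≡⟨ ∑-distrib-+ (λ i′ → b i′ * ∂ y (e i′)) (λ i′ → + δ i i′ * ∂ y (e i′)) ⟩
    sum (λ i′ → b i′ * ∂ y (e i′)) + sum (λ i′ → + δ i i′ * ∂ y (e i′))
      ≡⟨ cong₂ _+_ (b-boundary y) (sum-δ (∂ y ∘ e) i) ⟩
    (y v - y (tgt (e i))) + (y (tgt (e i)) - y (src (e i)))
      ≡⟨ telescope (y v) (y (tgt (e i))) (y (src (e i))) ⟩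
    y v - y (src (e i)) ∎
    where
    telescope : ∀ a b c → (a - b) + (b - c) ≡ a - c
    telescope = solve-∀
  connected⇒boundary e {v = v} (bwd (i , refl , refl) ◅ rest) with connected⇒boundary e rest
  ... | b , b-boundary = (λ i′ → b i′ - + δ i i′) , λ y → begin
    sum (λ i′ → (b i′ - + δ i i′) * ∂ y (e i′))
      ≡⟨ sum-cong-≗ (λ i′ → [y-z]x≈yx-zx (∂ y (e i′)) (b i′) _) ⟩
    sum (λ i′ → b i′ * ∂ y (e i′) - + δ i i′ * ∂ y (e i′))
      ≡⟨ ∑-distrib-- (λ i′ → b i′ * ∂ y (e i′)) (λ i′ → + δ i i′ * ∂ y (e i′)) ⟩
    sum (λ i′ → b i′ * ∂ y (e i′)) - sum (λ i′ → + δ i i′ * ∂ y (e i′))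
      ≡⟨ cong₂ _-_ (b-boundary y) (sum-δ (∂ y ∘ e) i) ⟩
    (y v - y (src (e i))) - (y (tgt (e i)) - y (src (e i)))
      ≡⟨ cancel (y v) (y (tgt (e i))) (y (src (e i))) ⟩
    y v - y (tgt (e i)) ∎
    where
    cancel : ∀ a b c → (a - c) - (b - c) ≡ a - b
    cancel = solve-∀

  closing-arc⇒dependent : ∀ {m} (e : Fin (suc m) → Fin t) →
    Connected (e ∘ suc) (src (e zero)) (tgt (e zero)) → Dependent e
  closing-arc⇒dependent e conn with connected⇒boundary (e ∘ suc) conn
  ... | b , b-boundary = (-1ℤ ∷ b) , cycle , zero , λ ()
    where
    cycle : IsCycle e (-1ℤ ∷ b)
    cycle y = begin
      -1ℤ * ∂ y (e zero) + sum (λ i → b i * ∂ y (e (suc i)))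
        ≡⟨ cong₂ _+_ (ℤP.-1*i≡-i (∂ y (e zero))) (b-boundary y) ⟩
      - ∂ y (e zero) + ∂ y (e zero)
        ≡⟨ ℤP.+-inverseˡ (∂ y (e zero)) ⟩
      0ℤ ∎

  dependent-∘suc : ∀ {m} (e : Fin (suc m) → Fin t) → Dependent (e ∘ suc) → Dependent e
  dependent-∘suc e (a , cycle , i , aᵢ≢0) =
    (0ℤ ∷ a) , (λ y → trans (ℤP.+-identityˡ _) (cycle y)) , suc i , aᵢ≢0

  -- y₀ certifies that the first arc leaves the span of the others.
  independent-∷ : ∀ {r} (g : Fin (suc r) → Fin t) (y₀ : Fin c → ℤ) →
    ∂ y₀ (g zero) ≢ 0ℤ → (∀ k → ∂ y₀ (g (suc k)) ≡ 0ℤ) → Independent (g ∘ suc) → Independent g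
  independent-∷ g y₀ ∂y₀≢0 ∂y₀≡0 independent a cycle = λ where
      zero    → a₀≡0
      (suc k) → independent (a ∘ suc) tail-cycle k
    where
    a₀≡0 : a zero ≡ 0ℤ
    a₀≡0 = fromInj₁ (⊥-elim ∘ ∂y₀≢0) (ℤP.i*j≡0⇒i≡0∨j≡0 (a zero) (begin
      a zero * ∂ y₀ (g zero)
        ≡⟨ sym (ℤP.+-identityʳ _) ⟩
      a zero * ∂ y₀ (g zero) + 0ℤ
        ≡⟨ cong (_+_ (a zero * ∂ y₀ (g zero))) (sym (sum-zero (λ k →
             trans (cong (a (suc k) *_) (∂y₀≡0 k)) (ℤP.*-zeroʳ (a (suc k)))))) ⟩
      a zero * ∂ y₀ (g zero) + sum (λ k → a (suc k) * ∂ y₀ (g (suc k)))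
        ≡⟨ cycle y₀ ⟩
      0ℤ ∎))
    tail-cycle : IsCycle (g ∘ suc) (a ∘ suc)
    tail-cycle y = begin
      sum (λ k → a (suc k) * ∂ y (g (suc k)))
        ≡⟨ sym (ℤP.+-identityˡ _) ⟩
      0ℤ * ∂ y (g zero) + sum (λ k → a (suc k) * ∂ y (g (suc k)))
        ≡⟨ cong (λ a₀ → a₀ * ∂ y (g zero) + sum (λ k → a (suc k) * ∂ y (g (suc k)))) (sym a₀≡0) ⟩
      a zero * ∂ y (g zero) + sum (λ k → a (suc k) * ∂ y (g (suc k)))
        ≡⟨ cycle y ⟩
      0ℤ ∎

  connected-∘suc : ∀ {m} (e : Fin (suc m) → Fin t) {k k′} →
    Connected (e ∘ suc) k k′ → Connected e k k′
  connected-∘suc e = EqClosure.map (λ (i , p , q) → suc i , p , q)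

  record SpanningForest {m} (e : Fin m → Fin t) : Set where
    field
      ℓ                    : ℕ
      component            : Fin c → Fin ℓ
      component-surjective : ∀ x → ∃[ k ] component k ≡ x
      component-connected  : ∀ {k k′} → component k ≡ component k′ → Connected e k k′
      edge-component       : ∀ {k k′} → Edge e k k′ → component k ≡ component k′
      r                    : ℕ
      tree                 : Fin r → Fin m
      tree-injective       : Injective _≡_ _≡_ tree
      tree-independent     : Independent (e ∘ tree)
      vertices≡ℓ+r         : c ≡ ℓ ℕ.+ r
      all-arcs-or-cycle    : r ≡ m ⊎ Dependent e

    component-respects : ∀ {k k′} → Connected e k k′ → component k ≡ component k′
    component-respects = EqClosure.gfold isEquivalence component edge-component

  open SpanningForest

  discrete-forest : (e : Fin 0 → Fin t) → SpanningForest e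
  discrete-forest e = record
    { ℓ = c ; component = id ; component-surjective = λ x → x , refl
    ; component-connected = λ { refl → ε } ; edge-component = λ { (() , _) }
    ; r = 0 ; tree = λ () ; tree-injective = λ { {()} } ; tree-independent = λ _ _ ()
    ; vertices≡ℓ+r = sym (ℕP.+-identityʳ c) ; all-arcs-or-cycle = inj₁ refl }

  module _ {m} (e : Fin (suc m) → Fin t) (F : SpanningForest (e ∘ suc)) where

    private
      u = src (e zero)
      v = tgt (e zero)

    add-arc-within : component F u ≡ component F v → SpanningForest e
    add-arc-within same = record
      { ℓ = ℓ F ; component = component F ; component-surjective = component-surjective F
      ; component-connected = connected-∘suc e ∘ component-connected F
      ; edge-component = λ { (zero , refl , refl) → same ; (suc i , p , q) → edge-component F (i , p , q) }
      ; r = r F ; tree = suc ∘ tree F ; tree-injective = tree-injective F ∘ suc-injective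
      ; tree-independent = tree-independent F ; vertices≡ℓ+r = vertices≡ℓ+r F
      ; all-arcs-or-cycle = inj₂ (closing-arc⇒dependent e (component-connected F same)) }

    add-arc-across : component F u ≢ component F v → SpanningForest e
    add-arc-across differ = record
      { ℓ = pred (ℓ F)
      ; component = merge′ ∘ component F
      ; component-surjective = surjective
      ; component-connected = connected
      ; edge-component = λ { (zero , refl , refl) → merge-identifies cu cv differ
                           ; (suc i , p , q) → cong merge′ (edge-component F (i , p , q)) }
      ; r = suc (r F)
      ; tree = lift 1 (tree F)
      ; tree-injective = lift-injective (tree F) (tree-injective F) 1
      ; tree-independent = independent-∷ (e ∘ lift 1 (tree F)) y₀ ∂y₀≢0
          (λ k → ∂-vanishes (λ x → + δ x cu) (component F) (edge-component F (tree F k , refl , refl)))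
          (tree-independent F)
      ; vertices≡ℓ+r = trans (vertices≡ℓ+r F)
          (trans (cong (ℕ._+ r F) (sym (ℕP.suc-pred (ℓ F) {{nonZeroIndex cu}})))
                 (sym (ℕP.+-suc (pred (ℓ F)) (r F))))
      ; all-arcs-or-cycle = ⊎.map (cong suc) (dependent-∘suc e) (all-arcs-or-cycle F)
      }
      where
      cu = component F u
      cv = component F v

      merge′ : Fin (ℓ F) → Fin (pred (ℓ F))
      merge′ = merge cu cv differ

      surjective : ∀ x → ∃[ k ] merge′ (component F k) ≡ x
      surjective x with merge-surjective cu cv differ x
      ... | z , refl with component-surjective F z
      ... | k , refl = k , refl

      connected-to-u : ∀ {k} → component F k ≡ cu ⊎ component F k ≡ cv → Connected e k u
      connected-to-u (inj₁ k~u) = connected-∘suc e (component-connected F k~u)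
      connected-to-u (inj₂ k~v) =
        connected-∘suc e (component-connected F k~v) ◅◅ (bwd (zero , refl , refl) ◅ ε)

      connected : ∀ {k k′} → merge′ (component F k) ≡ merge′ (component F k′) → Connected e k k′
      connected {k} {k′} eq with merge-fibres cu cv differ (component F k) (component F k′) eq
      ... | inj₁ same          = connected-∘suc e (component-connected F same)
      ... | inj₂ (k~uv , k′~uv) = connected-to-u k~uv ◅◅ EqClosure.symmetric _ (connected-to-u k′~uv)

      y₀ : Fin c → ℤ
      y₀ k = + δ (component F k) cu

      ∂y₀≢0 : ∂ y₀ (e zero) ≢ 0ℤ
      ∂y₀≢0 eq with trans (sym eq) (cong₂ (λ a b → + a - + b) (δ-≢ (differ ∘ sym)) (δ-refl cu))
      ... | ()

  forest : ∀ {m} (e : Fin m → Fin t) → SpanningForest e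
  forest {zero}  e = discrete-forest e
  forest {suc m} e with F ← forest (e ∘ suc) | component F (src (e zero)) ≟ component F (tgt (e zero))
  ... | yes same   = add-arc-within e F same
  ... | no differ  = add-arc-across e F differ

  fewer-components : ∀ {m m′} {e : Fin m → Fin t} {e′ : Fin m′ → Fin t} →
    (∀ {k k′} → Edge e′ k k′ → Edge e k k′) →
    (F : SpanningForest e) (G : SpanningForest e′) → ℓ F ℕ.≤ ℓ G
  fewer-components e′⊆e F G = injective⇒≤ relabel-injective
    where
    representative : ∀ x → ∃[ k ] component F k ≡ x
    representative = component-surjective F

    relabel-injective : Injective _≡_ _≡_ (component G ∘ proj₁ ∘ representative)
    relabel-injective {x} {x′} eq = begin
      x
        ≡⟨ sym (proj₂ (representative x)) ⟩
      component F (proj₁ (representative x))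
        ≡⟨ component-respects F (EqClosure.map e′⊆e (component-connected G eq)) ⟩
      component F (proj₁ (representative x′))
        ≡⟨ proj₂ (representative x′) ⟩
      x′ ∎

  forest-maximal : (F : SpanningForest id) (s : Fin (suc (r F)) → Fin t) → Dependent s
  forest-maximal F s = fromInj₂ (λ r≡ → ⊥-elim (ℕP.<-irrefl refl (c<c r≡))) (all-arcs-or-cycle G)
    where
    G = forest s

    c<c : r G ≡ suc (r F) → c < c
    c<c r≡ = subst₂ _<_ (sym (vertices≡ℓ+r F))
      (trans (cong (ℓ G ℕ.+_) (sym r≡)) (sym (vertices≡ℓ+r G)))
      (ℕP.+-mono-≤-< (fewer-components (λ (i , p , q) → s i , p , q) F G) (ℕP.n<1+n (r F)))

module _ {t} {N : Net t} {c} (I : Indexing N c) where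
  open Graph (src I) (tgt I)

  edge⇒arc : ∀ {k k′} → Edge id k k′ → Arc N (name I k) (name I k′)
  edge⇒arc (j , refl , refl) = j , sym (src-ok I j) , sym (tgt-ok I j)

  arc⇒edge : ∀ {k v} → Arc N (name I k) v → ∃[ k′ ] (name I k′ ≡ v × Edge id k k′)
  arc⇒edge (j , •j≡ , j•≡) =
    tgt I j , trans (tgt-ok I j) j•≡ , j , name-inj I (trans (src-ok I j) •j≡) , refl

  reverse-arc⇒edge : ∀ {k u} → Arc N u (name I k) → ∃[ k′ ] (name I k′ ≡ u × Edge id k′ k)
  reverse-arc⇒edge (j , •j≡ , j•≡) =
    src I j , trans (src-ok I j) •j≡ , j , refl , name-inj I (trans (tgt-ok I j) j•≡)

  symArc⇒symEdge : ∀ {k v} → SymClosure (Arc N) (name I k) v →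
    ∃[ k′ ] (name I k′ ≡ v × SymClosure (Edge id) k k′)
  symArc⇒symEdge (fwd a) = Σ.map₂ (Σ.map₂ fwd) (arc⇒edge a)
  symArc⇒symEdge (bwd a) = Σ.map₂ (Σ.map₂ bwd) (reverse-arc⇒edge a)

  source-named : ∀ {u v} → SymClosure (Arc N) u v → ∃[ k ] name I k ≡ u
  source-named (fwd (j , •j≡ , _)) = src I j , trans (src-ok I j) •j≡
  source-named (bwd (j , _ , j•≡)) = tgt I j , trans (tgt-ok I j) j•≡

  connected⇒sameComponent : ∀ {k k′} → Connected id k k′ → SameComponent N (name I k) (name I k′)
  connected⇒sameComponent = EqClosure.gmap (name I) edge⇒arc

  sameComponent⇒connected : ∀ {k k′} → SameComponent N (name I k) (name I k′) → Connected id k k′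
  sameComponent⇒connected {k} h with lift-Star (name I) symArc⇒symEdge h
  ... | k″ , eq , conn = subst (Connected id k) (name-inj I eq) conn

  star⇒reach : ∀ {k k′} → Star (Edge id) k k′ → Reach N (name I k) (name I k′)
  star⇒reach = Star.gmap (name I) edge⇒arc

  reach⇒star : ∀ {k k′} → Reach N (name I k) (name I k′) → Star (Edge id) k k′
  reach⇒star {k} h with lift-Star (name I) arc⇒edge h
  ... | k″ , eq , path = subst (Star (Edge id) k) (name-inj I eq) path

  weaklyReversible⇔ : WeaklyReversible N ⇔ WeaklyReversibleGraph
  weaklyReversible⇔ = mk⇔ to from
    where
    to : WeaklyReversible N → WeaklyReversibleGraph
    to wr conn = reach⇒star (wr _ _ (connected⇒sameComponent conn))

    from : WeaklyReversibleGraph → WeaklyReversible N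
    from wr u v ε = ε
    from wr u v h@(step ◅ _) with source-named step
    ... | k , refl with lift-Star (name I) symArc⇒symEdge h
    ... | k′ , refl , conn = star⇒reach (wr conn)

  W-as-∂ : ∀ i j → W N i j ≡ ∂ (λ k → + lookup (name I k) i) j
  W-as-∂ i j =
    sym (cong₂ (λ a b → + a - + b) (lookup-tabulate (tgt-ok I j) i) (lookup-tabulate (src-ok I j) i))

  dependent⇒¬colsIndependent : ∀ {m} {s : Fin m → Fin t} → Dependent s → ¬ ColsIndependent (W N) s
  dependent⇒¬colsIndependent {s = s} (a , cycle , k , aₖ≢0) independent = aₖ≢0 (independent a kernel k)
    where
    kernel : ∀ i → sumℤ (λ k → a k * W N i (s k)) ≡ 0ℤ
    kernel i = trans (sumℤ≡sum (λ k → a k * W N i (s k)))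
      (trans (sum-cong-≗ (λ k → cong (a k *_) (W-as-∂ i (s k)))) (cycle (λ k → + lookup (name I k) i)))

module Regulated {t} (N : Net t) {c} (I : Indexing N c) (m̄0 : Fin c → ℕ) where
  open Graph (src I) (tgt I)
  open Graph.SpanningForest

  M : Net t
  M = reactionNet N I m̄0 ⊙ N

  complex : Fin c → Vec ℕ (p M)
  complex k = tabulate ([ lookup (name I k) , δ k ] ∘ splitAt (p N))

  lookup-complex-reaction : ∀ k b → lookup (complex k) (p N ↑ʳ b) ≡ δ k b
  lookup-complex-reaction k b =
    trans (lookup∘tabulate _ (p N ↑ʳ b)) (cong [ lookup (name I k) , δ k ] (splitAt-↑ʳ (p N) c b))

  complex-injective : Injective _≡_ _≡_ complex
  complex-injective {k} {k′} eq = δ≡1⇒≡ (begin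
    δ k k′                          ≡⟨ sym (lookup-complex-reaction k k′) ⟩
    lookup (complex k) (p N ↑ʳ k′)  ≡⟨ cong (λ w → lookup w (p N ↑ʳ k′)) eq ⟩
    lookup (complex k′) (p N ↑ʳ k′) ≡⟨ lookup-complex-reaction k′ k′ ⟩
    δ k′ k′                         ≡⟨ δ-refl k′ ⟩
    1                               ∎)

  regulatedIndexing : Indexing M c
  regulatedIndexing = record
    { name     = complex
    ; name-inj = complex-injective
    ; src      = src I
    ; tgt      = tgt I
    ; src-ok   = λ j → tabulate-cong ([,]-cong (lookup-tabulate (src-ok I j)) (λ _ → refl) ∘ splitAt (p N))
    ; tgt-ok   = λ j → tabulate-cong ([,]-cong (lookup-tabulate (tgt-ok I j)) (λ _ → refl) ∘ splitAt (p N))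
    ; cover    = cover I
    }

  W-reaction-row : ∀ b j → W M (p N ↑ʳ b) j ≡ ∂ (basis b) j
  W-reaction-row b j rewrite splitAt-↑ʳ (p N) c b = refl

  independent⇒colsIndependent : ∀ {m} {s : Fin m → Fin t} → Independent s → ColsIndependent (W M) s
  independent⇒colsIndependent {s = s} independent a kernel =
    independent a (isCycle-from-basis s a (λ b →
      trans (sum-cong-≗ (λ k → cong (a k *_) (sym (W-reaction-row b (s k)))))
            (trans (sym (sumℤ≡sum (λ k → a k * W M (p N ↑ʳ b) (s k)))) (kernel (p N ↑ʳ b)))))

  weaklyReversible : WeaklyReversible M ⇔ WeaklyReversible N
  weaklyReversible = ⇔-sym (weaklyReversible⇔ I) ⇔-∘ weaklyReversible⇔ regulatedIndexing

  F : SpanningForest id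
  F = forest id

  deficiency-zero : HasDeficiency M 0ℤ
  deficiency-zero = c , regulatedIndexing , ℓ F , numComponents , r F , rank , defect
    where
    numComponents : NumComponents regulatedIndexing (ℓ F)
    numComponents = component F , component-surjective F , λ _ _ →
      connected⇒sameComponent regulatedIndexing ∘ component-connected F ,
      component-respects F ∘ sameComponent⇒connected regulatedIndexing

    rank : HasRank (W M) (r F)
    rank = (tree F , tree-injective F , independent⇒colsIndependent (tree-independent F)) ,
           λ s _ → dependent⇒¬colsIndependent regulatedIndexing {s = s} (forest-maximal F s)

    defect : 0ℤ ≡ + c - + ℓ F - + r F
    defect = trans (m+n-m-n≡0 (ℓ F) (r F)) (cong (λ z → + z - + ℓ F - + r F) (sym (vertices≡ℓ+r F)))

proposition6 : ∀ {t} (N : Net t) {c} (I : Indexing N c) (m̄0 : Fin c → ℕ) →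
    (WeaklyReversible (reactionNet N I m̄0 ⊙ N) ⇔ WeaklyReversible N)
    × HasDeficiency (reactionNet N I m̄0 ⊙ N) (+ 0)
proposition6 N I m̄0 = weaklyReversible , deficiency-zero
  where open Regulated N I m̄0
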